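{- Let $(V,\mathcal{Q})$ be a closure system such that $\varnothing\in\mathcal{Q}$ and $\{x\}\in\mathcal{Q}$ for all $x\in V$, and let $\pi\in\mathcal{D}(V,\mathcal{Q})$. Then $\pi$ is completely join-irreducible in the complete lattice $\mathcal{D}(V,\mathcal{Q})$ if and only if there exists a nonempty closed set $A\in\mathcal{Q}$ with $\pi=\pi_A$ such that $A$ admits a greatest proper decomposition into closed sets.
   Context: A closure system on a set $V$ is a pair $(V,\mathcal{Q})$ with $\mathcal{Q}\subseteq\mathcal{P}(V)$ closed under arbitrary intersections (so $V\in\mathcal{Q}$); members of $\mathcal{Q}$ are closed sets. A decomposition in $(V,\mathcal{Q})$ is a partition of $V$ (into nonempty blocks) all of whose blocks are closed; $\mathcal{D}(V,\mathcal{Q})$ is the set of decompositions, ordered by refinement ($\pi_1\le\pi_2$ iff every block of $\pi_2$ is a union of blocks of $\pi_1$); it is a complete lattice. For nonempty $A\in\mathcal{Q}$, $\pi_A=\{A\}\cup\{\{x\}: x\in V\setminus A\}$. A decomposition of $A$ into closed sets is a partition of $A$ into members of $\mathcal{Q}$; it is proper if it differs from $\{A\}$; "$A$ admits a greatest proper decomposition" means that among all proper decompositions of $A$ into closed sets there is a greatest one with respect to refinement. An element $j$ of a complete lattice $L$ is completely join-irreducible if $j\neq 0$ and $j=\bigvee\{x_i: i\in I\}$ implies $j=x_k$ for some $k\in I$. -}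

module Defs where

open import Level using (0ℓ) renaming (suc to lsuc)
open import Data.Product using (Σ; _×_; _,_)
open import Data.Sum using (_⊎_)
open import Data.Empty using (⊥)
open import Data.Unit using (⊤)
open import Relation.Nullary using (¬_)
open import Relation.Binary.PropositionalEquality using (_≡_)

Subset : Set → Set₁
Subset V = V → Set

Family : Set → Set₁
Family V = Subset V → Set

module _ {V : Set} where

  _⊆_ : Subset V → Subset V → Set
  S ⊆ T = ∀ {x} → S x → T x

  _≐_ : Subset V → Subset V → Set
  S ≐ T = (S ⊆ T) × (T ⊆ S)

  Nonempty : Subset V → Set
  Nonempty S = Σ V S

  ∅ : Subset V
  ∅ = λ _ → ⊥

  ⁅_⁆ : V → Subset V
  ⁅ x ⁆ = λ y → y ≡ x

  Whole : Subset V
  Whole = λ _ → ⊤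

-- (V, Q) is a closure system: Q is closed under arbitrary intersections
-- (of families indexed by any type I : Set; the empty family gives V ∈ Q).
-- Since subsets are predicates, membership in Q is required to be
-- invariant under extensional equality of subsets.
record ClosureSystem (V : Set) (Q : Family V) : Set₁ where
  field
    respects      : ∀ {S T : Subset V} → S ≐ T → Q S → Q T
    intersections : (I : Set) (F : I → Subset V) →
                    (∀ i → Q (F i)) → Q (λ x → ∀ i → F i x)

module _ {V : Set} where

  record IsPartitionOf (A : Subset V) (P : Family V) : Set₁ where
    field
      nonempty : ∀ {B} → P B → Nonempty B
      inside   : ∀ {B} → P B → B ⊆ A
      cover    : ∀ {x} → A x → Σ (Subset V) (λ B → P B × B x)
      disjoint : ∀ {B C x} → P B → P C → B x → C x → B ≐ C

  IsDecompositionOf : Family V → Subset V → Family V → Set₁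
  IsDecompositionOf Q A P = IsPartitionOf A P × (∀ {B} → P B → Q B)

  _≼_ : Family V → Family V → Set₁
  P₁ ≼ P₂ = ∀ {B} → P₂ B → ∀ {x} → B x →
            Σ (Subset V) (λ C → P₁ C × C x × C ⊆ B)

  _≈ᵇ_ : Family V → Family V → Set₁
  P ≈ᵇ P' = (∀ {S} → P S → Σ (Subset V) (λ T → P' T × S ≐ T))
          × (∀ {S} → P' S → Σ (Subset V) (λ T → P T × S ≐ T))

  OneBlock : Subset V → Family V
  OneBlock A = λ S → S ≐ A

  πBlocks : Subset V → Family V
  πBlocks A = λ S → (S ≐ A) ⊎ Σ V (λ x → ¬ A x × (S ≐ ⁅ x ⁆))

record Decomposition (V : Set) (Q : Family V) : Set₁ where
  field
    blocks   : Family V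
    isDecomp : IsDecompositionOf Q Whole blocks
open Decomposition public

module _ {V : Set} {Q : Family V} where

  _≤ᴰ_ : Decomposition V Q → Decomposition V Q → Set₁
  π₁ ≤ᴰ π₂ = blocks π₁ ≼ blocks π₂

  _≈ᴰ_ : Decomposition V Q → Decomposition V Q → Set₁
  π₁ ≈ᴰ π₂ = blocks π₁ ≈ᵇ blocks π₂

  IsJoin : {I : Set₁} → (I → Decomposition V Q) → Decomposition V Q → Set₁
  IsJoin {I} x j = (∀ i → x i ≤ᴰ j)
                 × (∀ (u : Decomposition V Q) → (∀ i → x i ≤ᴰ u) → j ≤ᴰ u)

  CompletelyJoinIrreducible : Decomposition V Q → Set₂
  CompletelyJoinIrreducible j =
      ¬ (∀ (π : Decomposition V Q) → j ≤ᴰ π)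
    × (∀ (I : Set₁) (x : I → Decomposition V Q) → IsJoin x j →
         Σ I (λ k → j ≈ᴰ x k))

module _ {V : Set} where

  IsProperDecompositionOf : Family V → Subset V → Family V → Set₁
  IsProperDecompositionOf Q A P = IsDecompositionOf Q A P × ¬ (P ≈ᵇ OneBlock A)

  HasGreatestProperDecomposition : Family V → Subset V → Set₁
  HasGreatestProperDecomposition Q A =
    Σ (Family V) (λ P → IsProperDecompositionOf Q A P
      × (∀ (P' : Family V) → IsProperDecompositionOf Q A P' → P' ≼ P))

-- Decompositions are compared through their same-block equivalence relations; meets are
-- intersections of these relations, whose classes are closed as intersections of blocks.
-- Every decomposition is the join of the π_D over its blocks D, so an irreducible π is
-- some π_A. The decompositions strictly below π_A are the extensions by singletons of the
-- proper decompositions of A. If A has a greatest proper decomposition G, a family with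
-- join π_A either has π_A as a member or lies below the extension of G, which cannot
-- have join π_A. Conversely, if π_A is irreducible, the join J of the extensions of all
-- proper decompositions of A stays strictly below π_A, and J restricted to A is the
-- greatest proper decomposition of A.
module Submission where

open import Defs
open import Level using (0ℓ; lift; lower) renaming (suc to lsuc)
open import Axiom.ExcludedMiddle using (ExcludedMiddle)
open import Data.Bool using (Bool; T)
open import Data.Empty using (⊥-elim)
open import Data.Product using (Σ; _×_; _,_; proj₁; proj₂)
open import Data.Sum using (_⊎_; inj₁; inj₂)
open import Data.Unit using (tt)
open import Function using (_∘_)
open import Function.Bundles using (_⇔_; mk⇔)
open import Relation.Binary.Core using (Rel; _⇒_)
open import Relation.Binary.Structures using (IsEquivalence)
open import Relation.Nullary using (¬_; Dec; yes; no)
open import Relation.Nullary.Decidable using (True; toWitness; fromWitness; map′)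
open import Relation.Binary.PropositionalEquality using (_≡_; refl; sym; trans)

module _ {V : Set} where

  open IsPartitionOf

  ≐-refl : {S : Subset V} → S ≐ S
  ≐-refl = (λ s → s) , (λ s → s)

  ≐-sym : {S T : Subset V} → S ≐ T → T ≐ S
  ≐-sym (S⊆T , T⊆S) = T⊆S , S⊆T

  ≈ᵇ-sym : {P₁ P₂ : Family V} → P₁ ≈ᵇ P₂ → P₂ ≈ᵇ P₁
  ≈ᵇ-sym (P₁⊑P₂ , P₂⊑P₁) = P₂⊑P₁ , P₁⊑P₂

  ≈ᵇ⇒≼ : {P₁ P₂ : Family V} → P₁ ≈ᵇ P₂ → P₁ ≼ P₂
  ≈ᵇ⇒≼ (_ , P₂⊑P₁) b Bx with P₂⊑P₁ b
  ... | C , c , B≐C = C , c , proj₁ B≐C Bx , proj₂ B≐C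

  ≼-trans : {P₁ P₂ P₃ : Family V} → P₁ ≼ P₂ → P₂ ≼ P₃ → P₁ ≼ P₃
  ≼-trans P₁≼P₂ P₂≼P₃ b Bx with P₂≼P₃ b Bx
  ... | C , c , Cx , C⊆B with P₁≼P₂ c Cx
  ...   | D , d , Dx , D⊆C = D , d , Dx , λ Dz → C⊆B (D⊆C Dz)

  ≼-antisym : {A B : Subset V} {P₁ P₂ : Family V} →
              IsPartitionOf A P₁ → IsPartitionOf B P₂ →
              P₁ ≼ P₂ → P₂ ≼ P₁ → P₁ ≈ᵇ P₂
  ≼-antisym p₁ p₂ P₁≼P₂ P₂≼P₁ = matched p₁ P₁≼P₂ P₂≼P₁ , matched p₂ P₂≼P₁ P₁≼P₂
    where
    matched : ∀ {A P P'} → IsPartitionOf A P → P ≼ P' → P' ≼ P →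
              ∀ {S} → P S → Σ (Subset V) (λ T → P' T × S ≐ T)
    matched p P≼P' P'≼P s with nonempty p s
    ... | x , Sx with P'≼P s Sx
    ...   | T , t , Tx , T⊆S with P≼P' t Tx
    ...     | S' , s' , S'x , S'⊆T =
              T , t , (λ Sz → S'⊆T (proj₁ (disjoint p s s' Sx S'x) Sz)) , T⊆S

  SameBlock : Family V → V → V → Set₁
  SameBlock P x y = Σ (Subset V) (λ B → P B × B x × B y)

  Connects : Family V → Subset V → Set₁
  Connects P A = ∀ {a b} → A a → A b → SameBlock P a b

  sameBlock-refl : ∀ {A P x} → IsPartitionOf A P → A x → SameBlock P x x
  sameBlock-refl p Ax with cover p Ax
  ... | B , b , Bx = B , b , Bx , Bx

  sameBlock-sym : ∀ {P x y} → SameBlock P x y → SameBlock P y x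
  sameBlock-sym (B , b , Bx , By) = B , b , By , Bx

  sameBlock-trans : ∀ {A P x y z} → IsPartitionOf A P →
                    SameBlock P x y → SameBlock P y z → SameBlock P x z
  sameBlock-trans p (B , b , Bx , By) (C , c , Cy , Cz) =
    C , c , proj₁ (disjoint p b c By Cy) Bx , Cz

  ≼⇒sameBlock : ∀ {A P₁ P₂} → IsPartitionOf A P₁ → IsPartitionOf A P₂ →
                P₁ ≼ P₂ → SameBlock P₁ ⇒ SameBlock P₂
  ≼⇒sameBlock p₁ p₂ P₁≼P₂ (C , c , Cx , Cy) with cover p₂ (inside p₁ c Cx)
  ... | B , b , Bx with P₁≼P₂ b Bx
  ...   | C' , c' , C'x , C'⊆B = B , b , Bx , C'⊆B (proj₁ (disjoint p₁ c c' Cx C'x) Cy)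

  sameBlock⇒≼ : ∀ {A P₁ P₂} → IsPartitionOf A P₁ → IsPartitionOf A P₂ →
                SameBlock P₁ ⇒ SameBlock P₂ → P₁ ≼ P₂
  sameBlock⇒≼ {P₁ = P₁} p₁ p₂ P₁⇒P₂ {B} b {x} Bx with cover p₁ (inside p₂ b Bx)
  ... | C , c , Cx = C , c , Cx , C⊆B
    where
    C⊆B : C ⊆ B
    C⊆B Cz with P₁⇒P₂ (C , c , Cx , Cz)
    ... | B' , b' , B'x , B'z = proj₂ (disjoint p₂ b b' Bx B'x) B'z

  ≈ᵇ⇒sameBlock : ∀ {P₁ P₂} → P₁ ≈ᵇ P₂ → SameBlock P₁ ⇒ SameBlock P₂
  ≈ᵇ⇒sameBlock (P₁⊑P₂ , _) (B , b , Bx , By) with P₁⊑P₂ b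
  ... | C , c , B≐C = C , c , proj₁ B≐C Bx , proj₁ B≐C By

  oneBlock-isPartition : ∀ {A} → Nonempty A → IsPartitionOf A (OneBlock A)
  oneBlock-isPartition {A} (a , Aa) = record
    { nonempty = λ S≐A → a , proj₂ S≐A Aa
    ; inside   = proj₁
    ; cover    = λ Ax → A , ≐-refl , Ax
    ; disjoint = λ (S⊆A , A⊆S) (T⊆A , A⊆T) _ _ → (λ Sz → A⊆T (S⊆A Sz)) , (λ Tz → A⊆S (T⊆A Tz))
    }

  oneBlock-connects : ∀ {A} → Connects (OneBlock A) A
  oneBlock-connects {A} Aa Ab = A , ≐-refl , Aa , Ab

  ≈oneBlock⇒connects : ∀ {A P} → P ≈ᵇ OneBlock A → Connects P A
  ≈oneBlock⇒connects P≈A Aa Ab = ≈ᵇ⇒sameBlock (≈ᵇ-sym P≈A) (oneBlock-connects Aa Ab)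

  connects⇒≈oneBlock : ∀ {A P} → IsPartitionOf A P → Nonempty A →
                       Connects P A → P ≈ᵇ OneBlock A
  connects⇒≈oneBlock {A} {P} p neA connected =
    ≼-antisym p (oneBlock-isPartition neA) P≼A A≼P
    where
    P≼A : P ≼ OneBlock A
    P≼A S≐A Sx with cover p (proj₁ S≐A Sx)
    ... | B , b , Bx = B , b , Bx , λ Bz → proj₂ S≐A (inside p b Bz)

    A≼P : OneBlock A ≼ P
    A≼P {B} b {x} Bx = A , ≐-refl , inside p b Bx , A⊆B
      where
      A⊆B : A ⊆ B
      A⊆B Az with connected (inside p b Bx) Az
      ... | C , c , Cx , Cz = proj₂ (disjoint p b c Bx Cx) Cz

  IsUnionOfBlocks : Family V → Subset V → Set₁
  IsUnionOfBlocks P A = ∀ {a z} → A a → SameBlock P a z → A z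

  Restrict : Subset V → Family V → Family V
  Restrict A P B = P B × B ⊆ A

  restrict-isPartition : ∀ {A P} → IsPartitionOf Whole P → IsUnionOfBlocks P A →
                         IsPartitionOf A (Restrict A P)
  restrict-isPartition {A} {P} p union = record
    { nonempty = λ (b , _) → nonempty p b
    ; inside   = proj₂
    ; cover    = cover′
    ; disjoint = λ (b , _) (c , _) → disjoint p b c
    }
    where
    cover′ : ∀ {a} → A a → Σ (Subset V) (λ B → Restrict A P B × B a)
    cover′ Aa with cover p tt
    ... | B , b , Ba = B , (b , λ Bz → union Aa (B , b , Ba , Bz)) , Ba

  sameBlock-restrict⁺ : ∀ {A P a b} → IsUnionOfBlocks P A → A a →
                        SameBlock P a b → SameBlock (Restrict A P) a b
  sameBlock-restrict⁺ union Aa (B , b , Ba , Bb) =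
    B , (b , λ Bz → union Aa (B , b , Ba , Bz)) , Ba , Bb

  sameBlock-restrict⁻ : ∀ {A P} → SameBlock (Restrict A P) ⇒ SameBlock P
  sameBlock-restrict⁻ (B , (b , _) , Ba , Bb) = B , b , Ba , Bb

  restrict≈oneBlock⇒connects : ∀ {A P} → Restrict A P ≈ᵇ OneBlock A → Connects P A
  restrict≈oneBlock⇒connects P|A≈A Aa Ab =
    sameBlock-restrict⁻ (≈oneBlock⇒connects P|A≈A Aa Ab)

  -- πBlocks A is Extend A (OneBlock A) by definition.
  Extend : Subset V → Family V → Family V
  Extend A P S = P S ⊎ Σ V (λ x → ¬ A x × (S ≐ ⁅ x ⁆))

  extend-isPartition : ∀ {A P} → (∀ x → Dec (A x)) → IsPartitionOf A P →
                       IsPartitionOf Whole (Extend A P)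
  extend-isPartition {A} {P} A? p = record
    { nonempty = nonempty′
    ; inside   = λ _ _ → tt
    ; cover    = λ {x} _ → cover′ x (A? x)
    ; disjoint = disjoint′
    }
    where
    nonempty′ : ∀ {B} → Extend A P B → Nonempty B
    nonempty′ (inj₁ b)              = nonempty p b
    nonempty′ (inj₂ (x , _ , B≐x)) = x , proj₂ B≐x refl

    cover′ : ∀ x → Dec (A x) → Σ (Subset V) (λ B → Extend A P B × B x)
    cover′ x (yes Ax) with cover p Ax
    ... | B , b , Bx = B , inj₁ b , Bx
    cover′ x (no ¬Ax) = ⁅ x ⁆ , inj₂ (x , ¬Ax , ≐-refl) , refl

    outside : ∀ {B C x y} → P B → B x → ¬ A y → C ≐ ⁅ y ⁆ → ¬ C x
    outside b Bx ¬Ay C≐y Cx with proj₁ C≐y Cx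
    ... | refl = ¬Ay (inside p b Bx)

    disjoint′ : ∀ {B C x} → Extend A P B → Extend A P C → B x → C x → B ≐ C
    disjoint′ (inj₁ b) (inj₁ c) Bx Cx = disjoint p b c Bx Cx
    disjoint′ (inj₁ b) (inj₂ (_ , ¬Ay , C≐y)) Bx Cx = ⊥-elim (outside b Bx ¬Ay C≐y Cx)
    disjoint′ (inj₂ (_ , ¬Ay , B≐y)) (inj₁ c) Bx Cx = ⊥-elim (outside c Cx ¬Ay B≐y Bx)
    disjoint′ (inj₂ (_ , _ , B≐y)) (inj₂ (_ , _ , C≐z)) Bx Cx =
        (λ Bw → proj₂ C≐z (trans (trans (proj₁ B≐y Bw) (sym (proj₁ B≐y Bx))) (proj₁ C≐z Cx)))
      , (λ Cw → proj₂ B≐y (trans (trans (proj₁ C≐z Cw) (sym (proj₁ C≐z Cx))) (proj₁ B≐y Bx)))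

  sameBlock-extend⁺ : ∀ {A P} → SameBlock P ⇒ SameBlock (Extend A P)
  sameBlock-extend⁺ (B , b , Bx , By) = B , inj₁ b , Bx , By

  sameBlock-extend⁻ : ∀ {A P x y} → SameBlock (Extend A P) x y → SameBlock P x y ⊎ x ≡ y
  sameBlock-extend⁻ (B , inj₁ b , Bx , By) = inj₁ (B , b , Bx , By)
  sameBlock-extend⁻ (B , inj₂ (_ , _ , B≐z) , Bx , By) =
    inj₂ (trans (proj₁ B≐z Bx) (sym (proj₁ B≐z By)))

  sameBlock-extend-inside : ∀ {A P x y} → IsPartitionOf A P → A x →
                            SameBlock (Extend A P) x y → SameBlock P x y
  sameBlock-extend-inside p Ax r with sameBlock-extend⁻ r
  ... | inj₁ r′   = r′
  ... | inj₂ refl = sameBlock-refl p Ax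

  sameBlock-πBlocks⁺ : ∀ {A} → Connects (πBlocks A) A
  sameBlock-πBlocks⁺ Aa Ab = sameBlock-extend⁺ (oneBlock-connects Aa Ab)

  sameBlock-πBlocks⁻ : ∀ {A x y} → SameBlock (πBlocks A) x y → (A x × A y) ⊎ x ≡ y
  sameBlock-πBlocks⁻ r with sameBlock-extend⁻ r
  ... | inj₁ (B , B≐A , Bx , By) = inj₁ (proj₁ B≐A Bx , proj₁ B≐A By)
  ... | inj₂ x≡y                = inj₂ x≡y

  Classes : Rel V 0ℓ → Family V
  Classes E S = Σ V (λ x → S ≐ E x)

  sameBlock-classes⁺ : {E : Rel V 0ℓ} → IsEquivalence E → E ⇒ SameBlock (Classes E)
  sameBlock-classes⁺ {E} isEquivalence {x} Exy =
    E x , (x , ≐-refl) , IsEquivalence.refl isEquivalence , Exy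

  sameBlock-classes⁻ : {E : Rel V 0ℓ} → IsEquivalence E → SameBlock (Classes E) ⇒ E
  sameBlock-classes⁻ isEquivalence (S , (z , S≐z) , Sx , Sy) =
    E.trans (E.sym (proj₁ S≐z Sx)) (proj₁ S≐z Sy)
    where module E = IsEquivalence isEquivalence

module _ {V : Set} {Q : Family V} where

  partition : (σ : Decomposition V Q) → IsPartitionOf Whole (blocks σ)
  partition σ = proj₁ (isDecomp σ)

  closed : (σ : Decomposition V Q) → ∀ {B} → blocks σ B → Q B
  closed σ = proj₂ (isDecomp σ)

  sameBlockᴰ-refl : (σ : Decomposition V Q) → ∀ {x} → SameBlock (blocks σ) x x
  sameBlockᴰ-refl σ = sameBlock-refl (partition σ) tt

  ≤ᴰ⇒sameBlock : (σ τ : Decomposition V Q) → σ ≤ᴰ τ →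
                 SameBlock (blocks σ) ⇒ SameBlock (blocks τ)
  ≤ᴰ⇒sameBlock σ τ = ≼⇒sameBlock (partition σ) (partition τ)

  sameBlock⇒≤ᴰ : (σ τ : Decomposition V Q) →
                 SameBlock (blocks σ) ⇒ SameBlock (blocks τ) → σ ≤ᴰ τ
  sameBlock⇒≤ᴰ σ τ = sameBlock⇒≼ (partition σ) (partition τ)

  ≈ᴰ⇒≤ᴰ : (σ τ : Decomposition V Q) → σ ≈ᴰ τ → σ ≤ᴰ τ
  ≈ᴰ⇒≤ᴰ _ _ = ≈ᵇ⇒≼

  ≤ᴰ-antisym : (σ τ : Decomposition V Q) → σ ≤ᴰ τ → τ ≤ᴰ σ → σ ≈ᴰ τ
  ≤ᴰ-antisym σ τ = ≼-antisym (partition σ) (partition τ)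

  ≈ᴰ-trans : (σ τ υ : Decomposition V Q) → σ ≈ᴰ τ → τ ≈ᴰ υ → σ ≈ᴰ υ
  ≈ᴰ-trans σ τ υ σ≈τ τ≈υ = ≤ᴰ-antisym σ υ
    (≼-trans (≈ᵇ⇒≼ σ≈τ) (≈ᵇ⇒≼ τ≈υ))
    (≼-trans (≈ᵇ⇒≼ (≈ᵇ-sym τ≈υ)) (≈ᵇ⇒≼ (≈ᵇ-sym σ≈τ)))

  isJoin-resp-≈ᴰ : {I : Set₁} {x : I → Decomposition V Q} (σ τ : Decomposition V Q) →
                   σ ≈ᴰ τ → IsJoin x σ → IsJoin x τ
  isJoin-resp-≈ᴰ _ _ σ≈τ (upper , least) =
      (λ i → ≼-trans (upper i) (≈ᵇ⇒≼ σ≈τ))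
    , (λ u ub → ≼-trans (≈ᵇ⇒≼ (≈ᵇ-sym σ≈τ)) (least u ub))

  irreducible-resp-≈ᴰ : (σ τ : Decomposition V Q) → σ ≈ᴰ τ →
                        CompletelyJoinIrreducible σ → CompletelyJoinIrreducible τ
  irreducible-resp-≈ᴰ σ τ σ≈τ (notBottom , irreducible) =
      (λ τ≤all → notBottom (λ υ → ≼-trans (≈ᵇ⇒≼ σ≈τ) (τ≤all υ)))
    , irreducible′
    where
    irreducible′ : ∀ (I : Set₁) (x : I → Decomposition V Q) → IsJoin x τ → Σ I (λ k → τ ≈ᴰ x k)
    irreducible′ I x τ=⋁x with irreducible I x (isJoin-resp-≈ᴰ {x = x} τ σ (≈ᵇ-sym σ≈τ) τ=⋁x)
    ... | k , σ≈xk = k , ≈ᴰ-trans τ σ (x k) (≈ᵇ-sym σ≈τ) σ≈xk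

module _ {V : Set} {Q : Family V} (cs : ClosureSystem V Q) where

  open ClosureSystem cs

  fromEquivalence : {E : Rel V 0ℓ} → IsEquivalence E → (∀ x → Q (E x)) →
                    Decomposition V Q
  fromEquivalence {E} isEquivalence closedClasses = record
    { blocks   = Classes E
    ; isDecomp = record
        { nonempty = λ (x , S≐x) → x , proj₂ S≐x E.refl
        ; inside   = λ _ _ → tt
        ; cover    = λ {x} _ → E x , (x , ≐-refl) , E.refl
        ; disjoint = λ (x , S≐x) (y , T≐y) Sz Tz →
              (λ Sw → proj₂ T≐y (classesMeet (proj₁ S≐x Sz) (proj₁ T≐y Tz) (proj₁ S≐x Sw)))
            , (λ Tw → proj₂ S≐x (classesMeet (proj₁ T≐y Tz) (proj₁ S≐x Sz) (proj₁ T≐y Tw)))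
        }
      , λ (x , S≐x) → respects (≐-sym S≐x) (closedClasses x)
    }
    where
    module E = IsEquivalence isEquivalence

    classesMeet : ∀ {x y z} → E x z → E y z → E x ⊆ E y
    classesMeet Exz Eyz Exw = E.trans (E.trans Eyz (E.sym Exz)) Exw

module Classical (lem : ExcludedMiddle (lsuc 0ℓ)) where

  decide : (P : Set) → Dec P
  decide P = map′ lower lift lem

  -- Excluded middle at level 1 makes Set₁-propositions small. Resize is a record rather
  -- than True (lem {P}) itself so that P can be inferred from Resize P.
  record Resize (P : Set₁) : Set where
    constructor resize′
    field isTrue : True (lem {P})

  resize : {P : Set₁} → P → Resize P
  resize p = resize′ (fromWitness p)

  unresize : {P : Set₁} → Resize P → P
  unresize (resize′ t) = toWitness t

  module Complete {V : Set} {Q : Family V} (cs : ClosureSystem V Q) where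

    open ClosureSystem cs
    open IsPartitionOf

    ⋂ : {I : Set₁} → (I → Subset V) → Subset V
    ⋂ F x = Resize (∀ i → F i x)

    ⋂-closed : {I : Set₁} (F : I → Subset V) → (∀ i → Q (F i)) → Q (⋂ F)
    ⋂-closed {I} F closedF =
      respects (small⊆large , large⊆small) (intersections Small (λ (χ , _) → T ∘ χ) closedSmall)
      where
      -- The family is re-indexed by the characteristic functions of its members.
      Small : Set
      Small = Σ (V → Bool) (λ χ → Resize (Σ I (λ i → F i ≐ (T ∘ χ))))

      closedSmall : (j : Small) → Q (T ∘ proj₁ j)
      closedSmall (χ , w) = let (i , Fi≐χ) = unresize w in respects Fi≐χ (closedF i)

      characteristic : ∀ i → F i ≐ (λ x → True (decide (F i x)))
      characteristic i = fromWitness , toWitness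

      small⊆large : (λ x → (j : Small) → T (proj₁ j x)) ⊆ ⋂ F
      small⊆large inAll = resize λ i →
        proj₂ (characteristic i) (inAll (_ , resize (i , characteristic i)))

      large⊆small : ⋂ F ⊆ (λ x → (j : Small) → T (proj₁ j x))
      large⊆small inAll (χ , w) = let (i , Fi≐χ) = unresize w in proj₁ Fi≐χ (unresize inAll i)

    MeetRel : (Decomposition V Q → Set₁) → Rel V 0ℓ
    MeetRel U x y = Resize (∀ u → U u → SameBlock (blocks u) x y)

    meetRel-isEquivalence : (U : Decomposition V Q → Set₁) → IsEquivalence (MeetRel U)
    meetRel-isEquivalence U = record
      { refl  = resize λ u _ → sameBlockᴰ-refl u
      ; sym   = λ r → resize λ u Uu → sameBlock-sym (unresize r u Uu)
      ; trans = λ r s → resize λ u Uu →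
                  sameBlock-trans (partition u) (unresize r u Uu) (unresize s u Uu)
      }

    -- The class of x is the intersection of the blocks of the u ∈ U that contain x.
    meetRel-closed : (U : Decomposition V Q → Set₁) → ∀ x → Q (MeetRel U x)
    meetRel-closed U x =
      respects (fromIntersection , toIntersection)
        (⋂-closed BlockOf λ (u , _ , _ , b , _) → closed u b)
      where
      BlockOf : Σ (Decomposition V Q) (λ u → U u × Σ (Subset V) (λ B → blocks u B × B x)) → Subset V
      BlockOf (_ , _ , B , _) = B

      fromIntersection : ⋂ BlockOf ⊆ MeetRel U x
      fromIntersection inAll = resize λ u Uu →
        let (B , b , Bx) = cover (partition u) tt
        in B , b , Bx , unresize inAll (u , Uu , B , b , Bx)

      toIntersection : MeetRel U x ⊆ ⋂ BlockOf
      toIntersection r = resize λ (u , Uu , B , b , Bx) →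
        let (C , c , Cx , Cy) = unresize r u Uu
        in proj₂ (disjoint (partition u) b c Bx Cx) Cy

    ⋀ : (Decomposition V Q → Set₁) → Decomposition V Q
    ⋀ U = fromEquivalence cs (meetRel-isEquivalence U) (meetRel-closed U)

    ⋀-lowerBound : (U : Decomposition V Q → Set₁) (u : Decomposition V Q) → U u → ⋀ U ≤ᴰ u
    ⋀-lowerBound U u Uu = sameBlock⇒≤ᴰ (⋀ U) u λ r →
      unresize (sameBlock-classes⁻ (meetRel-isEquivalence U) r) u Uu

    ⋀-greatest : (U : Decomposition V Q → Set₁) (σ : Decomposition V Q) →
                 (∀ u → U u → σ ≤ᴰ u) → σ ≤ᴰ ⋀ U
    ⋀-greatest U σ σ≤U = sameBlock⇒≤ᴰ σ (⋀ U) λ r →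
      sameBlock-classes⁺ (meetRel-isEquivalence U)
        (resize λ u Uu → ≤ᴰ⇒sameBlock σ u (σ≤U u Uu) r)

    ⋁ : {I : Set₁} → (I → Decomposition V Q) → Decomposition V Q
    ⋁ x = ⋀ (λ u → ∀ i → x i ≤ᴰ u)

    ⋁-isJoin : {I : Set₁} (x : I → Decomposition V Q) → IsJoin x (⋁ x)
    ⋁-isJoin x = (λ i → ⋀-greatest _ (x i) (λ u x≤u → x≤u i)) , ⋀-lowerBound _

  module Extensions {V : Set} {Q : Family V} (cs : ClosureSystem V Q)
                    (singletons : ∀ x → Q ⁅ x ⁆) where

    open ClosureSystem cs
    open Complete cs
    open IsPartitionOf

    extendᴰ : ∀ {A P} → IsDecompositionOf Q A P → Decomposition V Q
    extendᴰ {A} {P} d = record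
      { blocks   = Extend A P
      ; isDecomp = extend-isPartition (λ x → decide (A x)) (proj₁ d) , closedExtend
      }
      where
      closedExtend : ∀ {B} → Extend A P B → Q B
      closedExtend (inj₁ b)              = proj₂ d b
      closedExtend (inj₂ (x , _ , B≐x)) = respects (≐-sym B≐x) (singletons x)

    module _ {A : Subset V} (closedA : Q A) (neA : Nonempty A) where

      πᴰ : Decomposition V Q
      πᴰ = extendᴰ (oneBlock-isPartition neA , λ S≐A → respects (≐-sym S≐A) closedA)

      πᴰ-least : (σ : Decomposition V Q) → Connects (blocks σ) A → πᴰ ≤ᴰ σ
      πᴰ-least σ connected = sameBlock⇒≤ᴰ πᴰ σ λ r → case (sameBlock-πBlocks⁻ r)
        where
        case : ∀ {x y} → (A x × A y) ⊎ x ≡ y → SameBlock (blocks σ) x y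
        case (inj₁ (Ax , Ay)) = connected Ax Ay
        case (inj₂ refl)      = sameBlockᴰ-refl σ

      ≤πᴰ⇒isUnionOfBlocks : (σ : Decomposition V Q) → σ ≤ᴰ πᴰ → IsUnionOfBlocks (blocks σ) A
      ≤πᴰ⇒isUnionOfBlocks σ σ≤π Aa r with sameBlock-πBlocks⁻ (≤ᴰ⇒sameBlock σ πᴰ σ≤π r)
      ... | inj₁ (_ , Az) = Az
      ... | inj₂ refl     = Aa

      restrict-isDecomposition : (σ : Decomposition V Q) → σ ≤ᴰ πᴰ →
                                 IsDecompositionOf Q A (Restrict A (blocks σ))
      restrict-isDecomposition σ σ≤π =
        restrict-isPartition (partition σ) (≤πᴰ⇒isUnionOfBlocks σ σ≤π) , λ (b , _) → closed σ b

      extendᴰ-≤πᴰ : ∀ {P : Family V} (d : IsDecompositionOf Q A P) → extendᴰ d ≤ᴰ πᴰ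
      extendᴰ-≤πᴰ {P} d = sameBlock⇒≤ᴰ (extendᴰ d) πᴰ λ r → case (sameBlock-extend⁻ r)
        where
        case : ∀ {x y} → SameBlock P x y ⊎ x ≡ y → SameBlock (πBlocks A) x y
        case (inj₁ (B , b , Bx , By)) =
          sameBlock-πBlocks⁺ (inside (proj₁ d) b Bx) (inside (proj₁ d) b By)
        case (inj₂ refl)              = sameBlockᴰ-refl πᴰ

      ≤extendᴰ : ∀ {P} (d : IsDecompositionOf Q A P) (σ : Decomposition V Q) → σ ≤ᴰ πᴰ →
                 (∀ {a b} → A a → SameBlock (blocks σ) a b → SameBlock P a b) → σ ≤ᴰ extendᴰ d
      ≤extendᴰ d σ σ≤π σ|A⇒P = sameBlock⇒≤ᴰ σ (extendᴰ d) λ {a} r → case (decide (A a)) r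
        where
        case : ∀ {a b} → Dec (A a) → SameBlock (blocks σ) a b → SameBlock (blocks (extendᴰ d)) a b
        case (yes Aa) r = sameBlock-extend⁺ (σ|A⇒P Aa r)
        case (no ¬Aa) r with sameBlock-πBlocks⁻ (≤ᴰ⇒sameBlock σ πᴰ σ≤π r)
        ... | inj₁ (Aa , _) = ⊥-elim (¬Aa Aa)
        ... | inj₂ refl     = sameBlockᴰ-refl (extendᴰ d)

      πᴰ≰extendᴰ : ∀ {P} (proper : IsProperDecompositionOf Q A P) →
                   ¬ (πᴰ ≤ᴰ extendᴰ (proj₁ proper))
      πᴰ≰extendᴰ ((p , c) , nonTrivial) π≤P = nonTrivial (connects⇒≈oneBlock p neA λ Aa Ab →
        sameBlock-extend-inside p Aa
          (≤ᴰ⇒sameBlock πᴰ (extendᴰ (p , c)) π≤P (sameBlock-πBlocks⁺ Aa Ab)))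

      ≤extendᴰ-greatest : ∀ {G} → (G-proper : IsProperDecompositionOf Q A G) →
                          (∀ P → IsProperDecompositionOf Q A P → P ≼ G) →
                          (σ : Decomposition V Q) → σ ≤ᴰ πᴰ → ¬ Connects (blocks σ) A →
                          σ ≤ᴰ extendᴰ (proj₁ G-proper)
      ≤extendᴰ-greatest G-proper greatest σ σ≤π disconnected =
        ≤extendᴰ (proj₁ G-proper) σ σ≤π λ Aa r →
          ≼⇒sameBlock (proj₁ σ|A) (proj₁ (proj₁ G-proper)) (greatest _ σ|A-proper)
            (sameBlock-restrict⁺ (≤πᴰ⇒isUnionOfBlocks σ σ≤π) Aa r)
        where
        σ|A : IsDecompositionOf Q A (Restrict A (blocks σ))
        σ|A = restrict-isDecomposition σ σ≤π

        σ|A-proper : IsProperDecompositionOf Q A (Restrict A (blocks σ))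
        σ|A-proper = σ|A , λ σ|A≈A → disconnected (restrict≈oneBlock⇒connects σ|A≈A)

      πᴰ-irreducible : HasGreatestProperDecomposition Q A → CompletelyJoinIrreducible πᴰ
      πᴰ-irreducible (G , G-proper , greatest) =
          (λ π≤all → πᴰ≰extendᴰ G-proper (π≤all (extendᴰ (proj₁ G-proper))))
        , irreducible
        where
        -- Either some xₖ keeps A in one block, and then xₖ = π_A, or all of them lie below
        -- the extension of G, and then so does their join π_A, which is impossible.
        irreducible : ∀ (I : Set₁) (x : I → Decomposition V Q) →
                      IsJoin x πᴰ → Σ I (λ k → πᴰ ≈ᴰ x k)
        irreducible I x (upper , least) with lem {Σ I (λ k → Connects (blocks (x k)) A)}
        ... | yes (k , connected) = k , ≤ᴰ-antisym πᴰ (x k) (πᴰ-least (x k) connected) (upper k)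
        ... | no noneConnected    =
          ⊥-elim (πᴰ≰extendᴰ G-proper (least (extendᴰ (proj₁ G-proper)) λ i →
            ≤extendᴰ-greatest G-proper greatest (x i) (upper i) λ connected →
              noneConnected (i , connected)))

      πᴰ-irreducible⇒greatestProper : CompletelyJoinIrreducible πᴰ →
                                      HasGreatestProperDecomposition Q A
      πᴰ-irreducible⇒greatestProper (_ , irreducible) =
        Restrict A (blocks J) , (J|A , nonTrivial) , greatest
        where
        Proper : Set₁
        Proper = Σ (Family V) (IsProperDecompositionOf Q A)

        extendProper : Proper → Decomposition V Q
        extendProper (_ , d , _) = extendᴰ d

        J : Decomposition V Q
        J = ⋁ extendProper

        J≤π : J ≤ᴰ πᴰ
        J≤π = proj₂ (⋁-isJoin extendProper) πᴰ λ (_ , d , _) → extendᴰ-≤πᴰ d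

        J|A : IsDecompositionOf Q A (Restrict A (blocks J))
        J|A = restrict-isDecomposition J J≤π

        greatest : ∀ P → IsProperDecompositionOf Q A P → P ≼ Restrict A (blocks J)
        greatest P P-proper@(d , _) = sameBlock⇒≼ (proj₁ d) (proj₁ J|A) λ r@(B , b , Ba , _) →
          sameBlock-restrict⁺ (≤πᴰ⇒isUnionOfBlocks J J≤π) (inside (proj₁ d) b Ba)
            (≤ᴰ⇒sameBlock (extendᴰ d) J (proj₁ (⋁-isJoin extendProper) (P , P-proper))
              (sameBlock-extend⁺ r))

        -- If J kept A in one block it would equal π_A, so π_A would be the join of the
        -- extensions of proper decompositions of A, hence equal to one of them.
        J≈π : Connects (blocks J) A → J ≈ᴰ πᴰ
        J≈π connected = ≤ᴰ-antisym J πᴰ J≤π (πᴰ-least J connected)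

        π=⋁ : Connects (blocks J) A → IsJoin extendProper πᴰ
        π=⋁ connected =
          isJoin-resp-≈ᴰ {x = extendProper} J πᴰ (J≈π connected) (⋁-isJoin extendProper)

        nonTrivial : ¬ (Restrict A (blocks J) ≈ᵇ OneBlock A)
        nonTrivial J|A≈A =
          notExtension (irreducible Proper extendProper (π=⋁ (restrict≈oneBlock⇒connects J|A≈A)))
          where
          notExtension : ¬ Σ Proper (λ P → πᴰ ≈ᴰ extendProper P)
          notExtension ((_ , P-proper) , π≈P) =
            πᴰ≰extendᴰ P-proper (≈ᴰ⇒≤ᴰ πᴰ (extendᴰ (proj₁ P-proper)) π≈P)

    πᴰ-ofBlock : (π : Decomposition V Q) → Σ (Subset V) (blocks π) → Decomposition V Q
    πᴰ-ofBlock π (_ , d) = πᴰ (closed π d) (nonempty (partition π) d)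

    isJoin-πᴰ-ofBlock : (π : Decomposition V Q) → IsJoin (πᴰ-ofBlock π) π
    isJoin-πᴰ-ofBlock π =
        (λ (D , d) → πᴰ-least (closed π d) (nonempty (partition π) d) π λ Da Db → D , d , Da , Db)
      , (λ u ub → sameBlock⇒≤ᴰ π u λ (D , d , Da , Db) →
           ≤ᴰ⇒sameBlock (πᴰ-ofBlock π (D , d)) u (ub (D , d)) (sameBlock-πBlocks⁺ Da Db))

    irreducible⇒≈πᴰ : (π : Decomposition V Q) → CompletelyJoinIrreducible π →
                      Σ (Σ (Subset V) (blocks π)) (λ D → π ≈ᴰ πᴰ-ofBlock π D)
    irreducible⇒≈πᴰ π (_ , irreducible) =
      irreducible (Σ (Subset V) (blocks π)) (πᴰ-ofBlock π) (isJoin-πᴰ-ofBlock π)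

lemma2p2 : ExcludedMiddle (lsuc 0ℓ) →
           {V : Set} (Q : Family V) → ClosureSystem V Q →
           Q ∅ → (∀ x → Q ⁅ x ⁆) →
           (π : Decomposition V Q) →
           CompletelyJoinIrreducible π
             ⇔ Σ (Subset V) (λ A → Q A × Nonempty A
                 × (blocks π ≈ᵇ πBlocks A) × HasGreatestProperDecomposition Q A)
lemma2p2 lem Q cs _ singletons π = mk⇔
    (λ cji → let ((A , a) , π≈πA) = irreducible⇒≈πᴰ π cji
                 closedA = closed π a
                 neA     = IsPartitionOf.nonempty (partition π) a
             in A , closedA , neA , π≈πA ,
                πᴰ-irreducible⇒greatestProper closedA neA
                  (irreducible-resp-≈ᴰ π (πᴰ closedA neA) π≈πA cji))
    (λ (A , closedA , neA , π≈πA , greatestProper) →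
       irreducible-resp-≈ᴰ (πᴰ closedA neA) π (≈ᵇ-sym π≈πA)
         (πᴰ-irreducible closedA neA greatestProper))
  where
  open Classical lem
  open Extensions cs singletons
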